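{- Let $d>2$ be an integer, let $G=(\mathbb{Z}/d\mathbb{Z})^\times$, and let $H$ be a subgroup of $G$. Then $H$ is balanced if and only if $c_\chi=0$ for every odd character $\chi$ of $G$ whose restriction to $H$ is trivial.
   Context: Let $A_d\subset G$ be the set of residues having a representative in $(0,d/2)$ and $B_d=G\setminus A_d$. A subgroup $H$ of $G$ is called balanced if for every $u\in G$ we have $|uH\cap A_d|=|uH\cap B_d|$. For a character $\chi$ of $G$, viewed as a Dirichlet character modulo $d$ (so $\chi(a)=0$ if $\gcd(a,d)>1$), set $c_\chi=\sum_{0<a<d/2}\chi(a)$. A character $\chi$ is odd if $\chi(-1)=-1$. -}

module Defs where

open import Level using (Level; _⊔_) renaming (suc to lsuc)
open import Data.Nat as ℕ using (ℕ; zero; suc; NonZero; _<_; _∸_)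
open import Data.Nat.DivMod using (_mod_)
open import Data.Nat.Coprimality using (Coprime; coprime?)
open import Data.Bool using (Bool; true; false; if_then_else_; _∧_)
open import Data.Fin using (Fin; toℕ)
open import Data.Fin.Properties using (any?; _≟_)
open import Data.Fin.Subset using (Subset; _∈_; _∩_; _─_; ∣_∣)
open import Data.Fin.Subset.Properties using (_∈?_)
open import Data.Vec using (tabulate)
open import Data.List using (List; foldr; allFin)
open import Data.Product using (Σ; ∃; _×_; _,_)
open import Relation.Nullary using (¬_; does; _×-dec_)
open import Relation.Binary.PropositionalEquality using (_≡_)
open import Algebra.Bundles using (CommutativeRing)

module Residues (d : ℕ) .{{_ : NonZero d}} where

  res : ℕ → Fin d
  res n = n mod d

  mul : Fin d → Fin d → Fin d
  mul a b = res (toℕ a ℕ.* toℕ b)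

  one : Fin d
  one = res 1

  minusOne : Fin d
  minusOne = res (d ∸ 1)

  isUnit : Fin d → Bool
  isUnit a = does (coprime? (toℕ a) d)

  G : Subset d
  G = tabulate isUnit

  inHalf : Fin d → Bool
  inHalf a = does (ℕ._<?_ 0 (toℕ a)) ∧ does (ℕ._<?_ (2 ℕ.* toℕ a) d)

  A : Subset d
  A = tabulate (λ a → isUnit a ∧ inHalf a)

  B : Subset d
  B = G ─ A

  IsSubgroup : Subset d → Set
  IsSubgroup H =
    (∀ a → a ∈ H → a ∈ G) ×
    (one ∈ H) ×
    (∀ a b → a ∈ H → b ∈ H → mul a b ∈ H) ×
    (∀ a → a ∈ H → ∃ λ b → b ∈ H × mul a b ≡ one)

  coset : Fin d → Subset d → Subset d
  coset u H = tabulate (λ a → does (any? (λ h → (h ∈? H) ×-dec (a ≟ mul u h))))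

  Balanced : Subset d → Set
  Balanced H = ∀ u → u ∈ G → ∣ coset u H ∩ A ∣ ≡ ∣ coset u H ∩ B ∣

record Field (c ℓ : Level) : Set (lsuc (c ⊔ ℓ)) where
  field
    commutativeRing : CommutativeRing c ℓ
  open CommutativeRing commutativeRing public
  field
    0≉1     : ¬ (0# ≈ 1#)
    inverse : ∀ x → ¬ (x ≈ 0#) → ∃ λ y → (x * y) ≈ 1#

  _^_ : Carrier → ℕ → Carrier
  x ^ zero  = 1#
  x ^ suc n = x * (x ^ n)

  ι : ℕ → Carrier
  ι zero    = 0#
  ι (suc n) = 1# + ι n

  CharZero : Set ℓ
  CharZero = ∀ n → ¬ (ι (suc n) ≈ 0#)

  -- K contains a primitive n-th root of unity for every n ≥ 1
  -- (as ℂ does)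
  AllRootsOfUnity : Set (c ⊔ ℓ)
  AllRootsOfUnity = ∀ n → 0 < n →
    ∃ λ ζ → ((ζ ^ n) ≈ 1#) × (∀ k → 0 < k → k < n → ¬ ((ζ ^ k) ≈ 1#))

module Characters {c ℓ} (K : Field c ℓ) (d : ℕ) .{{_ : NonZero d}} where
  open Field K
  open Residues d

  -- χ : G → K^× homomorphism (given on residues; values on non-units
  -- are irrelevant, the Dirichlet extension below sets them to 0)
  IsCharacter : (Fin d → Carrier) → Set ℓ
  IsCharacter χ =
    (χ one ≈ 1#) ×
    (∀ a b → a ∈ G → b ∈ G → χ (mul a b) ≈ (χ a * χ b))

  dirichlet : (Fin d → Carrier) → Fin d → Carrier
  dirichlet χ a = if isUnit a then χ a else 0#

  cχ : (Fin d → Carrier) → Carrier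
  cχ χ = foldr (λ a s → (if inHalf a then dirichlet χ a else 0#) + s) 0# (allFin d)

  Odd : (Fin d → Carrier) → Set ℓ
  Odd χ = χ minusOne ≈ (- 1#)

  TrivialOn : Subset d → (Fin d → Carrier) → Set ℓ
  TrivialOn H χ = ∀ h → h ∈ H → χ h ≈ 1#

{-# OPTIONS --safe #-}
module Submission where

-- Write imb(u) = |uH ∩ A| − |uH ∩ B| and χ̃ for the Dirichlet extension of a character χ.
-- Since a ↦ −a exchanges A and B on units, Σ_u χ̃(u) imb(u) = (c_χ − χ(−1) c_χ) · Σ_{h∈H} χ(h),
-- and the last factor is |H| if χ is trivial on H and 0 otherwise. So if H is balanced
-- (imb = 0 on G), every odd χ trivial on H has 2 c_χ |H| = 0. Conversely, the hypothesis makes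
-- this transform of imb vanish for every character, and a function on G orthogonal to all
-- characters is zero: with a primitive d!-th root of unity ω, every test function splits into
-- simultaneous eigenvectors of the translations by units, and against such an eigenvector the
-- pairing is a multiple of a character sum.

open import Defs
open import Level using (Level; 0ℓ; _⊔_)
open import Data.Nat as ℕ using (ℕ; zero; suc; NonZero; _<_; _<?_; _∸_; _%_; _/_; s≤s; z≤n)
import Data.Nat.Properties as ℕP
open import Data.Nat.DivMod using (m%n<n; %-distribˡ-*; m%n%n≡m%n; [m+kn]%n≡m%n; m≡m%n+[m/n]*n; m<n⇒m%n≡m)
open import Data.Nat.Divisibility
  using (_∣_; _∣0; ∣-refl; ∣-trans; divides-refl; m∣m*n; m≤n⇒m!∣n!; ∣m∣n⇒∣m+n; %-presˡ-∣; ∣1⇒≡1; ∣m⇒∣m*n; ∣n⇒∣m*n)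
open import Data.Nat.Coprimality using (Coprime; coprime?; coprime-Bézout)
open import Data.Nat.GCD using (module Bézout)
open import Data.Nat.Tactic.RingSolver using (solve-∀)
open import Data.Bool using (Bool; true; false; _∧_; not; if_then_else_)
import Data.Bool.Properties as Boolₚ
open import Data.Fin as Fin using (Fin; toℕ)
open import Data.Fin.Properties using (toℕ-fromℕ<; toℕ-injective; toℕ<n; pigeonhole; any?; _≟_)
open import Data.Fin.Subset using (Subset; _∈_; _∩_; _─_; _⊆_; ∣_∣; ⁅_⁆)
open import Data.Fin.Subset.Properties using (_∈?_; p⊆q⇒∣p∣≤∣q∣; ∣⁅x⁆∣≡1; x∈⁅y⁆⇒x≡y)
open import Data.Fin.Permutation using (Permutation; permutation; _⟨$⟩ʳ_)
open import Data.Vec using (lookup; []; _∷_)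
open import Data.Vec.Properties using (lookup∘tabulate; lookup-zipWith; []=⇒lookup; lookup⇒[]=)
open import Data.List as List using (List; []; _∷_)
open import Data.List.Membership.Propositional using () renaming (_∈_ to _∈ₗ_)
open import Data.List.Membership.Propositional.Properties using (∈-allFin)
open import Data.List.Relation.Unary.Any using (here; there)
open import Data.Product using (∃; _×_; _,_; proj₁; proj₂)
open import Data.Sum using (_⊎_; inj₁; inj₂)
open import Data.Empty using (⊥-elim)
open import Function using (_∘_)
open import Function.Bundles using (_⇔_; mk⇔; Equivalence)
open import Relation.Binary.Definitions using (tri<; tri≈; tri>)
open import Relation.Nullary using (¬_; Dec; yes; no; does; _×-dec_)
open import Relation.Nullary.Decidable using (dec-true; does-⇔; ¬?)
open import Relation.Binary.PropositionalEquality as ≡ using (_≡_; _≢_)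
open import Algebra.Bundles using (CommutativeSemiring)
import Relation.Binary.Reasoning.Setoid as SetoidReasoning
import Algebra.Solver.Ring.NaturalCoefficients.Default as NaturalSolver
import Algebra.Properties.Semiring.Sum as SemiringSum
import Algebra.Properties.Ring as RingProperties
import Algebra.Properties.AbelianGroup as AbelianGroupProperties

does≡true⇒ : ∀ {P : Set} (p? : Dec P) → does p? ≡ true → P
does≡true⇒ (yes p) _ = p

Bool-ext : ∀ {b c : Bool} → (b ≡ true → c ≡ true) → (c ≡ true → b ≡ true) → b ≡ c
Bool-ext {true}  b⇒c _ = ≡.sym (b⇒c ≡.refl)
Bool-ext {false} {true} _ c⇒b = c⇒b ≡.refl
Bool-ext {false} {false} _ _ = ≡.refl

∧-not-∧ : ∀ {u a b} → (u ≡ true → a ≡ not b) → u ∧ not (u ∧ a) ≡ u ∧ b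
∧-not-∧ {false} _ = ≡.refl
∧-not-∧ {true} {b = b} a≡¬b = ≡.trans (≡.cong not (a≡¬b ≡.refl)) (Boolₚ.not-involutive b)

lookup-─ : ∀ {n} (p q : Subset n) i → lookup (p ─ q) i ≡ lookup p i ∧ not (lookup q i)
lookup-─ (x ∷ p) (true  ∷ q) Fin.zero = ≡.sym (Boolₚ.∧-zeroʳ x)
lookup-─ (x ∷ p) (false ∷ q) Fin.zero = ≡.sym (Boolₚ.∧-identityʳ x)
lookup-─ (x ∷ p) (y ∷ q) (Fin.suc i) = lookup-─ p q i

pred-mul-split : ∀ {m n} → 0 < m → m ℕ.≤ n → (n ∸ 1) ℕ.* m ≡ (n ∸ m) ℕ.+ (m ∸ 1) ℕ.* n
pred-mul-split {suc t} {n} _ m≤n =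
  ≡.subst (λ n → (n ∸ 1) ℕ.* suc t ≡ (n ∸ suc t) ℕ.+ t ℕ.* n) (ℕP.m+[n∸m]≡n m≤n)
        (≡.trans (regroup t s) (≡.cong (ℕ._+ t ℕ.* suc (t ℕ.+ s)) (≡.sym (ℕP.m+n∸m≡n t s))))
  where
  s : ℕ
  s = n ∸ suc t
  regroup : ∀ t s → (t ℕ.+ s) ℕ.* suc t ≡ s ℕ.+ t ℕ.* suc (t ℕ.+ s)
  regroup = solve-∀

m∣n! : ∀ {m n} → 0 < m → m ℕ.≤ n → m ∣ n ℕ.!
m∣n! {suc m} _ 1+m≤n = ∣-trans (m∣m*n (m ℕ.!)) (m≤n⇒m!∣n! 1+m≤n)

double<+⇔< : ∀ t s → 2 ℕ.* t < t ℕ.+ s ⇔ t < s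
double<+⇔< t s = mk⇔
  (λ 2t<t+s → ℕP.+-cancelˡ-< t t s (≡.subst (_< t ℕ.+ s) (two* t) 2t<t+s))
  (λ t<s → ≡.subst (_< t ℕ.+ s) (≡.sym (two* t)) (ℕP.+-monoʳ-< t t<s))
  where
  two* : ∀ t → 2 ℕ.* t ≡ t ℕ.+ t
  two* t = ≡.cong (t ℕ.+_) (ℕP.+-identityʳ t)

below-half-swap : ∀ t s → t ≢ s → does (2 ℕ.* s <? s ℕ.+ t) ≡ not (does (2 ℕ.* t <? t ℕ.+ s))
below-half-swap t s t≢s = does-⇔ (mk⇔ to from) (2 ℕ.* s <? s ℕ.+ t) (¬? (2 ℕ.* t <? t ℕ.+ s))
  where
  to : 2 ℕ.* s < s ℕ.+ t → ¬ (2 ℕ.* t < t ℕ.+ s)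
  to 2s<s+t 2t<t+s = ℕP.<-asym (Equivalence.to (double<+⇔< s t) 2s<s+t) (Equivalence.to (double<+⇔< t s) 2t<t+s)
  from : ¬ (2 ℕ.* t < t ℕ.+ s) → 2 ℕ.* s < s ℕ.+ t
  from 2t≮t+s = Equivalence.from (double<+⇔< s t)
    (ℕP.≤∧≢⇒< (ℕP.≮⇒≥ (2t≮t+s ∘ Equivalence.from (double<+⇔< t s))) (t≢s ∘ ≡.sym))

x∈p⇒0<∣p∣ : ∀ {n} {x : Fin n} {p : Subset n} → x ∈ p → 0 < ∣ p ∣
x∈p⇒0<∣p∣ {x = x} {p} x∈p = ℕP.≤-trans (ℕP.≤-reflexive (≡.sym (∣⁅x⁆∣≡1 x))) (p⊆q⇒∣p∣≤∣q∣ ⁅x⁆⊆p)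
  where
  ⁅x⁆⊆p : ⁅ x ⁆ ⊆ p
  ⁅x⁆⊆p y∈⁅x⁆ = ≡.subst (_∈ p) (≡.sym (x∈⁅y⁆⇒x≡y x y∈⁅x⁆)) x∈p

∀[P⊎Q]⇒∀P⊎Q : ∀ {p q} {n} {P : Fin n → Set p} {Q : Set q} → (∀ i → P i ⊎ Q) → (∀ i → P i) ⊎ Q
∀[P⊎Q]⇒∀P⊎Q {n = zero}  P⊎Q = inj₁ (λ ())
∀[P⊎Q]⇒∀P⊎Q {n = suc n} P⊎Q with P⊎Q Fin.zero | ∀[P⊎Q]⇒∀P⊎Q (P⊎Q ∘ Fin.suc)
... | inj₂ q  | _       = inj₂ q
... | inj₁ _  | inj₂ q  = inj₂ q
... | inj₁ p₀ | inj₁ pₛ = inj₁ λ { Fin.zero → p₀ ; (Fin.suc i) → pₛ i }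

module NatIndexedSum {c ℓ : Level} (R : CommutativeSemiring c ℓ) where
  open CommutativeSemiring R hiding (zero)
  open SetoidReasoning setoid
  open NaturalSolver R using (solve; _:=_; _:+_)

  ∑ℕ : ℕ → (ℕ → Carrier) → Carrier
  ∑ℕ zero    h = 0#
  ∑ℕ (suc n) h = h zero + ∑ℕ n (λ i → h (suc i))

  ∑ℕ-cong : ∀ n {h h′ : ℕ → Carrier} → (∀ i → h i ≈ h′ i) → ∑ℕ n h ≈ ∑ℕ n h′
  ∑ℕ-cong zero    h≈h′ = refl
  ∑ℕ-cong (suc n) h≈h′ = +-cong (h≈h′ zero) (∑ℕ-cong n (λ i → h≈h′ (suc i)))

  ∑ℕ-zero : ∀ n {h : ℕ → Carrier} → (∀ i → i < n → h i ≈ 0#) → ∑ℕ n h ≈ 0#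
  ∑ℕ-zero zero    h≈0 = refl
  ∑ℕ-zero (suc n) h≈0 =
    trans (+-cong (h≈0 zero (s≤s z≤n)) (∑ℕ-zero n (λ i i<n → h≈0 (suc i) (s≤s i<n)))) (+-identityˡ 0#)

  ∑ℕ-last : ∀ n (h : ℕ → Carrier) → ∑ℕ (suc n) h ≈ ∑ℕ n h + h n
  ∑ℕ-last zero    h = trans (+-identityʳ _) (sym (+-identityˡ _))
  ∑ℕ-last (suc n) h = trans (+-congˡ (∑ℕ-last n (λ i → h (suc i)))) (sym (+-assoc _ _ _))

  ∑ℕ-rotate : ∀ n (h : ℕ → Carrier) → h n ≈ h zero → ∑ℕ n (λ i → h (suc i)) ≈ ∑ℕ n h
  ∑ℕ-rotate zero    h hn≈h0 = refl
  ∑ℕ-rotate (suc n) h hn≈h0 = begin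
    ∑ℕ (suc n) (λ i → h (suc i))     ≈⟨ ∑ℕ-last n (λ i → h (suc i)) ⟩
    ∑ℕ n (λ i → h (suc i)) + h (suc n) ≈⟨ +-congˡ hn≈h0 ⟩
    ∑ℕ n (λ i → h (suc i)) + h zero  ≈⟨ +-comm _ _ ⟩
    ∑ℕ (suc n) h                     ∎

  *-distribˡ-∑ℕ : ∀ n x (h : ℕ → Carrier) → x * ∑ℕ n h ≈ ∑ℕ n (λ i → x * h i)
  *-distribˡ-∑ℕ zero    x h = zeroʳ x
  *-distribˡ-∑ℕ (suc n) x h = trans (distribˡ _ _ _) (+-congˡ (*-distribˡ-∑ℕ n x (λ i → h (suc i))))

  *-distribʳ-∑ℕ : ∀ n x (h : ℕ → Carrier) → ∑ℕ n h * x ≈ ∑ℕ n (λ i → h i * x)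
  *-distribʳ-∑ℕ n x h = trans (*-comm _ _) (trans (*-distribˡ-∑ℕ n x h) (∑ℕ-cong n (λ i → *-comm x (h i))))

  ∑ℕ-distrib-+ : ∀ n (h h′ : ℕ → Carrier) → ∑ℕ n (λ i → h i + h′ i) ≈ ∑ℕ n h + ∑ℕ n h′
  ∑ℕ-distrib-+ zero    h h′ = sym (+-identityˡ 0#)
  ∑ℕ-distrib-+ (suc n) h h′ = trans (+-congˡ (∑ℕ-distrib-+ n (λ i → h (suc i)) (λ i → h′ (suc i))))
    (solve 4 (λ a b c e → (a :+ b) :+ (c :+ e) := (a :+ c) :+ (b :+ e)) refl _ _ _ _)

  ∑ℕ-comm : ∀ m n (h : ℕ → ℕ → Carrier) → ∑ℕ m (λ i → ∑ℕ n (h i)) ≈ ∑ℕ n (λ j → ∑ℕ m (λ i → h i j))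
  ∑ℕ-comm zero    n h = sym (∑ℕ-zero n (λ _ _ → refl))
  ∑ℕ-comm (suc m) n h = trans (+-congˡ (∑ℕ-comm m n (λ i → h (suc i))))
    (sym (∑ℕ-distrib-+ n (h zero) (λ j → ∑ℕ m (λ i → h (suc i) j))))

  open SemiringSum semiring using (sum; ∑-distrib-+)

  ∑-∑ℕ-comm : ∀ {m} n (h : Fin m → ℕ → Carrier) → sum (λ y → ∑ℕ n (h y)) ≈ ∑ℕ n (λ j → sum (λ y → h y j))
  ∑-∑ℕ-comm {m} zero    h = SemiringSum.sum-replicate-zero semiring m
  ∑-∑ℕ-comm     (suc n) h = trans (∑-distrib-+ (λ y → h y zero) (λ y → ∑ℕ n (λ j → h y (suc j))))
    (+-congˡ (∑-∑ℕ-comm n (λ y j → h y (suc j))))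

module FieldProperties {c ℓ : Level} (K : Field c ℓ) where
  open Field K hiding (zero)
  open SetoidReasoning setoid
  open RingProperties ring using ([y-z]x≈yx-zx; -‿involutive)
  open AbelianGroupProperties +-abelianGroup using (x∙y⁻¹≈ε⇒x≈y; x≈y⇒x∙y⁻¹≈ε; ε⁻¹≈ε; ⁻¹-∙-comm; ∙-cancelˡ)
  open SemiringSum semiring public using (sum; ∑-comm; ∑-distrib-+; *-distribˡ-sum; *-distribʳ-sum; sum-cong-≋; ∑-permute)
  open NatIndexedSum commutativeSemiring public

  *-cancelˡ-≉0 : ∀ {x y z} → ¬ (x ≈ 0#) → x * y ≈ x * z → y ≈ z
  *-cancelˡ-≉0 {x} {y} {z} x≉0 xy≈xz with inverse x x≉0
  ... | x⁻¹ , xx⁻¹≈1 = begin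
    y              ≈⟨ sym (*-identityˡ y) ⟩
    1# * y         ≈⟨ *-congʳ (trans (sym xx⁻¹≈1) (*-comm x x⁻¹)) ⟩
    x⁻¹ * x * y    ≈⟨ *-assoc x⁻¹ x y ⟩
    x⁻¹ * (x * y)  ≈⟨ *-congˡ xy≈xz ⟩
    x⁻¹ * (x * z)  ≈⟨ *-assoc x⁻¹ x z ⟨
    x⁻¹ * x * z    ≈⟨ *-congʳ (trans (*-comm x⁻¹ x) xx⁻¹≈1) ⟩
    1# * z         ≈⟨ *-identityˡ z ⟩
    z              ∎

  zero-product : ∀ {x y} → ¬ (x ≈ 0#) → x * y ≈ 0# → y ≈ 0#
  zero-product x≉0 xy≈0 = *-cancelˡ-≉0 x≉0 (trans xy≈0 (sym (zeroʳ _)))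

  distinct-eigenvalues : ∀ {a b z} → ¬ (a ≈ b) → a * z ≈ b * z → z ≈ 0#
  distinct-eigenvalues {a} {b} {z} a≉b az≈bz =
    zero-product (a≉b ∘ x∙y⁻¹≈ε⇒x≈y a b) (trans ([y-z]x≈yx-zx z a b) (x≈y⇒x∙y⁻¹≈ε az≈bz))

  x²≈1⇒x≈-1 : ∀ {x} → x * x ≈ 1# → ¬ (x ≈ 1#) → x ≈ - 1#
  x²≈1⇒x≈-1 {x} x²≈1 x≉1 = x∙y⁻¹≈ε⇒x≈y x (- 1#) (trans (+-congˡ (-‿involutive 1#)) x+1≈0)
    where
    x+1≈0 : x + 1# ≈ 0#
    x+1≈0 = distinct-eigenvalues x≉1 (begin
      x * (x + 1#)   ≈⟨ distribˡ x x 1# ⟩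
      x * x + x * 1# ≈⟨ +-cong x²≈1 (*-identityʳ x) ⟩
      1# + x         ≈⟨ +-comm 1# x ⟩
      x + 1#         ≈⟨ *-identityˡ _ ⟨
      1# * (x + 1#)  ∎)

  [_] : Bool → Carrier
  [ true  ] = 1#
  [ false ] = 0#

  [∧] : ∀ a b → [ a ∧ b ] ≈ [ a ] * [ b ]
  [∧] true  b = sym (*-identityˡ _)
  [∧] false b = sym (zeroˡ _)

  foldr-tabulate : ∀ {m n} (g : Fin m → Carrier) (h : Fin n → Fin m) →
                   List.foldr (λ a s → g a + s) 0# (List.tabulate h) ≡.≡ sum (λ i → g (h i))
  foldr-tabulate {n = zero}  g h = ≡.refl
  foldr-tabulate {n = suc n} g h = ≡.cong (g (h Fin.zero) +_) (foldr-tabulate g (λ i → h (Fin.suc i)))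

  ∑-zero : ∀ {n} (f : Fin n → Carrier) → (∀ i → f i ≈ 0#) → sum f ≈ 0#
  ∑-zero {n} f f≈0 = trans (sum-cong-≋ f≈0) (SemiringSum.sum-replicate-zero semiring n)

  ∑-neg : ∀ {n} (f : Fin n → Carrier) → sum (λ i → - f i) ≈ - sum f
  ∑-neg {zero}  f = sym ε⁻¹≈ε
  ∑-neg {suc n} f = trans (+-congˡ (∑-neg (λ i → f (Fin.suc i)))) (⁻¹-∙-comm _ _)

  ∑-distrib-sub : ∀ {n} (f g : Fin n → Carrier) → sum (λ i → f i - g i) ≈ sum f - sum g
  ∑-distrib-sub f g = trans (∑-distrib-+ f (λ i → - g i)) (+-congˡ (∑-neg g))

  ∑-select : ∀ {n} (g : Fin n → Carrier) v → sum (λ i → g i * [ does (i ≟ v) ]) ≈ g v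
  ∑-select {suc n} g Fin.zero =
    trans (+-cong (*-identityʳ _) (∑-zero (λ i → g (Fin.suc i) * 0#) (λ i → zeroʳ _))) (+-identityʳ _)
  ∑-select {suc n} g (Fin.suc v) = trans (+-cong (zeroʳ _) (∑-select (λ i → g (Fin.suc i)) v)) (+-identityˡ _)

  ι-∣∣ : ∀ {n} (p : Subset n) → ι ∣ p ∣ ≈ sum (λ i → [ lookup p i ])
  ι-∣∣ []          = refl
  ι-∣∣ (true  ∷ p) = +-congˡ (ι-∣∣ p)
  ι-∣∣ (false ∷ p) = trans (ι-∣∣ p) (sym (+-identityˡ _))

  ∑ℕ-1 : ∀ n → ∑ℕ n (λ _ → 1#) ≈ ι n
  ∑ℕ-1 zero    = refl
  ∑ℕ-1 (suc n) = +-congˡ (∑ℕ-1 n)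

  module _ (charZero : CharZero) where

    ι-injective : ∀ m n → ι m ≈ ι n → m ≡.≡ n
    ι-injective zero    zero    _ = ≡.refl
    ι-injective zero    (suc n) 0≈ι = ⊥-elim (charZero n (sym 0≈ι))
    ι-injective (suc m) zero    ι≈0 = ⊥-elim (charZero m ι≈0)
    ι-injective (suc m) (suc n) 1+ιm≈1+ιn = ≡.cong suc (ι-injective m n (∙-cancelˡ 1# (ι m) (ι n) 1+ιm≈1+ιn))

    1+1≉0 : ¬ (1# + 1# ≈ 0#)
    1+1≉0 1+1≈0 = charZero 1 (trans (+-congˡ (+-identityʳ 1#)) 1+1≈0)

  ^-cong : ∀ {x y} n → x ≈ y → x ^ n ≈ y ^ n
  ^-cong zero    x≈y = refl
  ^-cong (suc n) x≈y = *-cong x≈y (^-cong n x≈y)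

  ^-+ : ∀ x m n → x ^ (m ℕ.+ n) ≈ x ^ m * x ^ n
  ^-+ x zero    n = sym (*-identityˡ _)
  ^-+ x (suc m) n = trans (*-congˡ (^-+ x m n)) (sym (*-assoc _ _ _))

  1^n≈1 : ∀ n → 1# ^ n ≈ 1#
  1^n≈1 zero    = refl
  1^n≈1 (suc n) = trans (*-identityˡ _) (1^n≈1 n)

  ^-* : ∀ x m n → x ^ (m ℕ.* n) ≈ (x ^ m) ^ n
  ^-* x m zero    = reflexive (≡.cong (x ^_) (ℕP.*-zeroʳ m))
  ^-* x m (suc n) = begin
    x ^ (m ℕ.* suc n)     ≡⟨ ≡.cong (x ^_) (ℕP.*-suc m n) ⟩
    x ^ (m ℕ.+ m ℕ.* n)   ≈⟨ ^-+ x m (m ℕ.* n) ⟩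
    x ^ m * x ^ (m ℕ.* n) ≈⟨ *-congˡ (^-* x m n) ⟩
    x ^ m * (x ^ m) ^ n   ∎

  geometric-sum : ∀ n x → x ^ n ≈ 1# → ¬ (x ≈ 1#) → ∑ℕ n (x ^_) ≈ 0#
  geometric-sum n x xⁿ≈1 x≉1 = distinct-eigenvalues x≉1 (begin
    x * ∑ℕ n (x ^_)          ≈⟨ *-distribˡ-∑ℕ n x (x ^_) ⟩
    ∑ℕ n (λ i → x ^ suc i)   ≈⟨ ∑ℕ-rotate n (x ^_) xⁿ≈1 ⟩
    ∑ℕ n (x ^_)              ≈⟨ *-identityˡ _ ⟨
    1# * ∑ℕ n (x ^_)         ∎)

module UnitsModulo (d : ℕ) .{{_ : NonZero d}} where
  open Residues d
  open ≡ using (refl; sym; trans; cong; cong₂; subst)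
  open ≡.≡-Reasoning

  toℕ-res : ∀ n → toℕ (res n) ≡ n % d
  toℕ-res n = toℕ-fromℕ< (m%n<n n d)

  res-cong : ∀ {m n} → m % d ≡ n % d → res m ≡ res n
  res-cong eq = toℕ-injective (trans (toℕ-res _) (trans eq (sym (toℕ-res _))))

  res-toℕ : ∀ a → res (toℕ a) ≡ a
  res-toℕ a = toℕ-injective (trans (toℕ-res _) (m<n⇒m%n≡m (toℕ<n a)))

  res-%ˡ : ∀ m n → res ((m % d) ℕ.* n) ≡ res (m ℕ.* n)
  res-%ˡ m n = res-cong (begin
    ((m % d) ℕ.* n) % d             ≡⟨ %-distribˡ-* (m % d) n d ⟩
    ((m % d % d) ℕ.* (n % d)) % d   ≡⟨ cong (λ z → (z ℕ.* (n % d)) % d) (m%n%n≡m%n m d) ⟩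
    ((m % d) ℕ.* (n % d)) % d       ≡⟨ sym (%-distribˡ-* m n d) ⟩
    (m ℕ.* n) % d                   ∎)

  res-%ʳ : ∀ m n → res (m ℕ.* (n % d)) ≡ res (m ℕ.* n)
  res-%ʳ m n = trans (cong res (ℕP.*-comm m (n % d))) (trans (res-%ˡ n m) (cong res (ℕP.*-comm n m)))

  mul-resˡ : ∀ m b → mul (res m) b ≡ res (m ℕ.* toℕ b)
  mul-resˡ m b = trans (cong (λ z → res (z ℕ.* toℕ b)) (toℕ-res m)) (res-%ˡ m (toℕ b))

  mul-resʳ : ∀ a m → mul a (res m) ≡ res (toℕ a ℕ.* m)
  mul-resʳ a m = trans (cong (λ z → res (toℕ a ℕ.* z)) (toℕ-res m)) (res-%ʳ (toℕ a) m)

  mul-comm : ∀ a b → mul a b ≡ mul b a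
  mul-comm a b = cong res (ℕP.*-comm (toℕ a) (toℕ b))

  mul-assoc : ∀ a b c → mul (mul a b) c ≡ mul a (mul b c)
  mul-assoc a b c = begin
    mul (mul a b) c                 ≡⟨ mul-resˡ (toℕ a ℕ.* toℕ b) c ⟩
    res (toℕ a ℕ.* toℕ b ℕ.* toℕ c) ≡⟨ cong res (ℕP.*-assoc (toℕ a) (toℕ b) (toℕ c)) ⟩
    res (toℕ a ℕ.* (toℕ b ℕ.* toℕ c)) ≡⟨ sym (mul-resʳ a (toℕ b ℕ.* toℕ c)) ⟩
    mul a (mul b c)                 ∎

  mul-identityʳ : ∀ a → mul a one ≡ a
  mul-identityʳ a = trans (mul-resʳ a 1) (trans (cong res (ℕP.*-identityʳ (toℕ a))) (res-toℕ a))

  mul-identityˡ : ∀ a → mul one a ≡ a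
  mul-identityˡ a = trans (mul-comm one a) (mul-identityʳ a)

  mul-interchange : ∀ a b c e → mul (mul a b) (mul c e) ≡ mul (mul a c) (mul b e)
  mul-interchange a b c e = begin
    mul (mul a b) (mul c e) ≡⟨ mul-assoc a b (mul c e) ⟩
    mul a (mul b (mul c e)) ≡⟨ cong (mul a) (sym (mul-assoc b c e)) ⟩
    mul a (mul (mul b c) e) ≡⟨ cong (λ z → mul a (mul z e)) (mul-comm b c) ⟩
    mul a (mul (mul c b) e) ≡⟨ cong (mul a) (mul-assoc c b e) ⟩
    mul a (mul c (mul b e)) ≡⟨ sym (mul-assoc a c (mul b e)) ⟩
    mul (mul a c) (mul b e) ∎

  mul-swapˡ : ∀ a b c → mul a (mul b c) ≡ mul b (mul a c)
  mul-swapˡ a b c = trans (sym (mul-assoc a b c)) (trans (cong (λ z → mul z c) (mul-comm a b)) (mul-assoc b a c))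

  ∈G⇒isUnit : ∀ {a} → a ∈ G → isUnit a ≡ true
  ∈G⇒isUnit {a} a∈G = trans (sym (lookup∘tabulate isUnit a)) ([]=⇒lookup a∈G)

  isUnit⇒∈G : ∀ {a} → isUnit a ≡ true → a ∈ G
  isUnit⇒∈G {a} a-unit = lookup⇒[]= a G (trans (lookup∘tabulate isUnit a) a-unit)

  ∈G⇒Coprime : ∀ {a} → a ∈ G → Coprime (toℕ a) d
  ∈G⇒Coprime {a} = does≡true⇒ (coprime? (toℕ a) d) ∘ ∈G⇒isUnit

  Coprime⇒∈G : ∀ {a} → Coprime (toℕ a) d → a ∈ G
  Coprime⇒∈G {a} = isUnit⇒∈G ∘ dec-true (coprime? (toℕ a) d)

  ∈G⇒invertible : ∀ {a} → a ∈ G → ∃ λ b → mul a b ≡ one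
  ∈G⇒invertible {a} a∈G with coprime-Bézout (∈G⇒Coprime a∈G)
  ... | Bézout.+- x y eq = res x , trans (mul-resʳ a x) (res-cong (begin
    (toℕ a ℕ.* x) % d   ≡⟨ cong (_% d) (trans (ℕP.*-comm (toℕ a) x) (sym eq)) ⟩
    (1 ℕ.+ y ℕ.* d) % d ≡⟨ [m+kn]%n≡m%n 1 y d ⟩
    1 % d               ∎))
  ... | Bézout.-+ x y eq = res (x ℕ.* (d ∸ 1)) , trans (mul-resʳ a (x ℕ.* (d ∸ 1))) (res-cong (begin
    (toℕ a ℕ.* (x ℕ.* k)) % d               ≡⟨ sym ([m+kn]%n≡m%n (toℕ a ℕ.* (x ℕ.* k)) 1 d) ⟩
    (toℕ a ℕ.* (x ℕ.* k) ℕ.+ 1 ℕ.* d) % d   ≡⟨ cong (_% d) key ⟩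
    (1 ℕ.+ (y ℕ.* k) ℕ.* d) % d             ≡⟨ [m+kn]%n≡m%n 1 (y ℕ.* k) d ⟩
    1 % d                                   ∎))
    where
    -- x·a ≡ −1 (mod d), so x·(d − 1)·a ≡ 1
    k : ℕ
    k = d ∸ 1
    d≡1+k : d ≡ suc k
    d≡1+k = sym (ℕP.suc-pred d)
    key : toℕ a ℕ.* (x ℕ.* k) ℕ.+ 1 ℕ.* d ≡ 1 ℕ.+ (y ℕ.* k) ℕ.* d
    key = begin
      toℕ a ℕ.* (x ℕ.* k) ℕ.+ 1 ℕ.* d       ≡⟨ cong (λ z → toℕ a ℕ.* (x ℕ.* k) ℕ.+ 1 ℕ.* z) d≡1+k ⟩
      toℕ a ℕ.* (x ℕ.* k) ℕ.+ 1 ℕ.* suc k   ≡⟨ regroup₁ (toℕ a) x k ⟩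
      1 ℕ.+ (1 ℕ.+ x ℕ.* toℕ a) ℕ.* k       ≡⟨ cong (λ z → 1 ℕ.+ z ℕ.* k) (trans eq (cong (y ℕ.*_) d≡1+k)) ⟩
      1 ℕ.+ (y ℕ.* suc k) ℕ.* k             ≡⟨ regroup₂ y k ⟩
      1 ℕ.+ (y ℕ.* k) ℕ.* suc k             ≡⟨ cong (λ z → 1 ℕ.+ (y ℕ.* k) ℕ.* z) (sym d≡1+k) ⟩
      1 ℕ.+ (y ℕ.* k) ℕ.* d                 ∎
      where
      regroup₁ : ∀ a x k → a ℕ.* (x ℕ.* k) ℕ.+ 1 ℕ.* suc k ≡ 1 ℕ.+ (1 ℕ.+ x ℕ.* a) ℕ.* k
      regroup₁ = solve-∀
      regroup₂ : ∀ y k → 1 ℕ.+ (y ℕ.* suc k) ℕ.* k ≡ 1 ℕ.+ (y ℕ.* k) ℕ.* suc k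
      regroup₂ = solve-∀

  invertible⇒∈G : ∀ {a b} → mul a b ≡ one → a ∈ G
  invertible⇒∈G {a} {b} ab≡1 = Coprime⇒∈G coprime
    where
    ab%d≡1%d : (toℕ a ℕ.* toℕ b) % d ≡ 1 % d
    ab%d≡1%d = trans (sym (toℕ-res _)) (trans (cong toℕ ab≡1) (toℕ-res 1))
    coprime : Coprime (toℕ a) d
    coprime {c} (c∣a , c∣d) =
      ∣1⇒≡1 (subst (c ∣_) (sym (m≡m%n+[m/n]*n 1 d)) (∣m∣n⇒∣m+n c∣1%d (∣n⇒∣m*n (1 / d) c∣d)))
      where
      c∣1%d : c ∣ 1 % d
      c∣1%d = subst (c ∣_) ab%d≡1%d (%-presˡ-∣ (∣m⇒∣m*n (toℕ b) c∣a) c∣d)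

  one∈G : one ∈ G
  one∈G = invertible⇒∈G (mul-identityʳ one)

  mul∈G : ∀ {a b} → a ∈ G → b ∈ G → mul a b ∈ G
  mul∈G {a} {b} a∈G b∈G with ∈G⇒invertible a∈G | ∈G⇒invertible b∈G
  ... | a⁻¹ , aa⁻¹≡1 | b⁻¹ , bb⁻¹≡1 = invertible⇒∈G {b = mul a⁻¹ b⁻¹} (begin
    mul (mul a b) (mul a⁻¹ b⁻¹) ≡⟨ mul-interchange a b a⁻¹ b⁻¹ ⟩
    mul (mul a a⁻¹) (mul b b⁻¹) ≡⟨ cong₂ mul aa⁻¹≡1 bb⁻¹≡1 ⟩
    mul one one                 ≡⟨ mul-identityʳ one ⟩
    one                         ∎)

  mul∈G⇒∈G : ∀ {a x} → mul a x ∈ G → x ∈ G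
  mul∈G⇒∈G {a} {x} ax∈G with ∈G⇒invertible ax∈G
  ... | y , axy≡1 = invertible⇒∈G {b = mul a y} (trans (mul-swapˡ x a y) (trans (sym (mul-assoc a x y)) axy≡1))

  isUnit-mulˡ : ∀ {a} → a ∈ G → ∀ x → isUnit (mul a x) ≡ isUnit x
  isUnit-mulˡ {a} a∈G x =
    Bool-ext (λ ax∈G → ∈G⇒isUnit {x} (mul∈G⇒∈G {a} (isUnit⇒∈G {mul a x} ax∈G)))
             (λ x∈G → ∈G⇒isUnit {mul a x} (mul∈G a∈G (isUnit⇒∈G {x} x∈G)))

  mul-cancelˡ : ∀ {a} → a ∈ G → ∀ {x y} → mul a x ≡ mul a y → x ≡ y
  mul-cancelˡ {a} a∈G {x} {y} ax≡ay with ∈G⇒invertible a∈G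
  ... | b , ab≡1 = begin
    x               ≡⟨ sym (mul-identityˡ x) ⟩
    mul one x       ≡⟨ cong (λ z → mul z x) ba≡1 ⟨
    mul (mul b a) x ≡⟨ mul-assoc b a x ⟩
    mul b (mul a x) ≡⟨ cong (mul b) ax≡ay ⟩
    mul b (mul a y) ≡⟨ mul-assoc b a y ⟨
    mul (mul b a) y ≡⟨ cong (λ z → mul z y) ba≡1 ⟩
    mul one y       ≡⟨ mul-identityˡ y ⟩
    y               ∎
    where
    ba≡1 : mul b a ≡ one
    ba≡1 = trans (mul-comm b a) ab≡1

  pow : Fin d → ℕ → Fin d
  pow g zero    = one
  pow g (suc j) = mul g (pow g j)

  pow-+ : ∀ g i j → pow g (i ℕ.+ j) ≡ mul (pow g i) (pow g j)
  pow-+ g zero    j = sym (mul-identityˡ _)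
  pow-+ g (suc i) j = trans (cong (mul g) (pow-+ g i j)) (sym (mul-assoc g _ _))

  pow-* : ∀ g i j → pow g (j ℕ.* i) ≡ pow (pow g i) j
  pow-* g i zero    = refl
  pow-* g i (suc j) = trans (pow-+ g i (j ℕ.* i)) (cong (mul (pow g i)) (pow-* g i j))

  pow-one : ∀ j → pow one j ≡ one
  pow-one zero    = refl
  pow-one (suc j) = trans (cong (mul one) (pow-one j)) (mul-identityʳ one)

  pow∈G : ∀ {g} → g ∈ G → ∀ j → pow g j ∈ G
  pow∈G g∈G zero    = one∈G
  pow∈G g∈G (suc j) = mul∈G g∈G (pow∈G g∈G j)

  pow-period : ∀ {g} → g ∈ G → ∃ λ r → 0 < r × r ℕ.≤ d × pow g r ≡ one
  pow-period {g} g∈G with pigeonhole (ℕP.n<1+n d) (λ i → pow g (toℕ i))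
  ... | i , j , i<j , gⁱ≡gʲ = r , ℕP.m<n⇒0<n∸m i<j , r≤d , sym (mul-cancelˡ (pow∈G g∈G (toℕ i)) gⁱ≡gⁱ⁺ʳ)
    where
    r : ℕ
    r = toℕ j ∸ toℕ i
    r≤d : r ℕ.≤ d
    r≤d = ℕP.≤-trans (ℕP.m∸n≤m (toℕ j) (toℕ i)) (ℕP.≤-pred (toℕ<n j))
    gⁱ≡gⁱ⁺ʳ : mul (pow g (toℕ i)) one ≡ mul (pow g (toℕ i)) (pow g r)
    gⁱ≡gⁱ⁺ʳ = trans (mul-identityʳ _) (trans gⁱ≡gʲ
      (trans (cong (pow g) (sym (ℕP.m+[n∸m]≡n (ℕP.<⇒≤ i<j)))) (pow-+ g (toℕ i) r)))

  pow-multiple : ∀ g {r n} → r ∣ n → pow g r ≡ one → pow g n ≡ one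
  pow-multiple g {r} (divides-refl q) gʳ≡1 = trans (pow-* g r q) (trans (cong (λ z → pow z q) gʳ≡1) (pow-one q))

  IsExponent : ℕ → Set
  IsExponent M = ∀ {g} → g ∈ G → pow g M ≡ one

  d!-exponent : IsExponent (d ℕ.!)
  d!-exponent {g} g∈G = let r , 0<r , r≤d , gʳ≡1 = pow-period g∈G in pow-multiple g (m∣n! 0<r r≤d) gʳ≡1

  lookup-A : ∀ a → lookup A a ≡ isUnit a ∧ inHalf a
  lookup-A = lookup∘tabulate (λ a → isUnit a ∧ inHalf a)

  lookup-B : ∀ a → lookup B a ≡ isUnit a ∧ not (isUnit a ∧ inHalf a)
  lookup-B a = trans (lookup-─ G A a) (cong₂ (λ u v → u ∧ not v) (lookup∘tabulate isUnit a) (lookup-A a))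

module Reflection (d : ℕ) .{{_ : NonZero d}} (2<d : 2 < d) where
  open Residues d
  open UnitsModulo d
  open ≡ using (refl; sym; trans; cong; cong₂; subst)
  open ≡.≡-Reasoning

  1<d : 1 < d
  1<d = ℕP.<-trans (s≤s (s≤s z≤n)) 2<d

  toℕ-minusOne : toℕ minusOne ≡ d ∸ 1
  toℕ-minusOne = trans (toℕ-res (d ∸ 1)) (m<n⇒m%n≡m (ℕP.m<n+o⇒m∸n<o d 1 (ℕP.n<1+n d)))

  minusOne² : mul minusOne minusOne ≡ one
  minusOne² = begin
    res (toℕ minusOne ℕ.* toℕ minusOne) ≡⟨ cong (λ z → res (z ℕ.* z)) toℕ-minusOne ⟩
    res ((d ∸ 1) ℕ.* (d ∸ 1))           ≡⟨ res-cong (cong (_% d) (pred-mul-split 0<d-1 (ℕP.m∸n≤m d 1))) ⟩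
    res (d ∸ (d ∸ 1) ℕ.+ (d ∸ 1 ∸ 1) ℕ.* d) ≡⟨ res-cong ([m+kn]%n≡m%n (d ∸ (d ∸ 1)) (d ∸ 1 ∸ 1) d) ⟩
    res (d ∸ (d ∸ 1))                   ≡⟨ cong res (ℕP.m∸[m∸n]≡n (ℕP.<⇒≤ 1<d)) ⟩
    one                                 ∎
    where
    0<d-1 : 0 < d ∸ 1
    0<d-1 = ℕP.m<n⇒0<n∸m 1<d

  minusOne∈G : minusOne ∈ G
  minusOne∈G = invertible⇒∈G minusOne²

  toℕ-minusOne* : ∀ x → 0 < toℕ x → toℕ (mul minusOne x) ≡ d ∸ toℕ x
  toℕ-minusOne* x 0<x = begin
    toℕ (res (toℕ minusOne ℕ.* toℕ x))           ≡⟨ toℕ-res _ ⟩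
    (toℕ minusOne ℕ.* toℕ x) % d                 ≡⟨ cong (λ z → (z ℕ.* toℕ x) % d) toℕ-minusOne ⟩
    ((d ∸ 1) ℕ.* toℕ x) % d                      ≡⟨ cong (_% d) (pred-mul-split 0<x (ℕP.<⇒≤ (toℕ<n x))) ⟩
    (d ∸ toℕ x ℕ.+ (toℕ x ∸ 1) ℕ.* d) % d        ≡⟨ [m+kn]%n≡m%n (d ∸ toℕ x) (toℕ x ∸ 1) d ⟩
    (d ∸ toℕ x) % d                              ≡⟨ m<n⇒m%n≡m (ℕP.∸-monoʳ-< 0<x (ℕP.<⇒≤ (toℕ<n x))) ⟩
    d ∸ toℕ x                                    ∎

  ∈G⇒nonzero : ∀ {x} → x ∈ G → 0 < toℕ x
  ∈G⇒nonzero {x} x∈G with toℕ x | ∈G⇒Coprime x∈G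
  ... | suc _ | _       = s≤s z≤n
  ... | zero  | coprime = ⊥-elim (ℕP.<-irrefl (sym (coprime (d ∣0 , ∣-refl))) 1<d)

  ∈G⇒≢complement : ∀ {x} → x ∈ G → toℕ x ≢ d ∸ toℕ x
  ∈G⇒≢complement {x} x∈G x≡d-x = ℕP.<-irrefl (sym d≡2) 2<d
    where
    -- x divides d = 2x, so x = gcd(x, d) = 1
    d≡x+x : d ≡ toℕ x ℕ.+ toℕ x
    d≡x+x = trans (sym (ℕP.m+[n∸m]≡n (ℕP.<⇒≤ (toℕ<n x)))) (cong (toℕ x ℕ.+_) (sym x≡d-x))
    x≡1 : toℕ x ≡ 1
    x≡1 = ∈G⇒Coprime x∈G (∣-refl , subst (toℕ x ∣_) (sym d≡x+x) (∣m∣n⇒∣m+n ∣-refl ∣-refl))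
    d≡2 : d ≡ 2
    d≡2 = trans d≡x+x (cong₂ ℕ._+_ x≡1 x≡1)

  inHalf-∈G : ∀ {x} → x ∈ G → inHalf x ≡ does (2 ℕ.* toℕ x <? d)
  inHalf-∈G {x} x∈G = cong (_∧ does (2 ℕ.* toℕ x <? d)) (dec-true (0 <? toℕ x) (∈G⇒nonzero x∈G))

  inHalf-minusOne* : ∀ {x} → x ∈ G → inHalf (mul minusOne x) ≡ not (inHalf x)
  inHalf-minusOne* {x} x∈G = begin
    inHalf (mul minusOne x)                ≡⟨ inHalf-∈G (mul∈G minusOne∈G x∈G) ⟩
    does (2 ℕ.* toℕ (mul minusOne x) <? d) ≡⟨ cong (λ z → does (2 ℕ.* z <? d)) (toℕ-minusOne* x (∈G⇒nonzero x∈G)) ⟩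
    does (2 ℕ.* s <? d)                    ≡⟨ cong (λ n → does (2 ℕ.* s <? n)) d≡t+s ⟩
    does (2 ℕ.* s <? t ℕ.+ s)              ≡⟨ cong (λ n → does (2 ℕ.* s <? n)) (ℕP.+-comm t s) ⟩
    does (2 ℕ.* s <? s ℕ.+ t)              ≡⟨ below-half-swap t s (∈G⇒≢complement x∈G) ⟩
    not (does (2 ℕ.* t <? t ℕ.+ s))        ≡⟨ cong (λ n → not (does (2 ℕ.* t <? n))) d≡t+s ⟨
    not (does (2 ℕ.* t <? d))              ≡⟨ cong not (inHalf-∈G x∈G) ⟨
    not (inHalf x)                         ∎
    where
    t s : ℕ
    t = toℕ x
    s = d ∸ toℕ x
    d≡t+s : d ≡ t ℕ.+ s
    d≡t+s = sym (ℕP.m+[n∸m]≡n (ℕP.<⇒≤ (toℕ<n x)))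

  B-minusOne* : ∀ x → lookup B (mul minusOne x) ≡ lookup A x
  B-minusOne* x = begin
    lookup B (mul minusOne x)                                 ≡⟨ lookup-B (mul minusOne x) ⟩
    isUnit (mul minusOne x) ∧ not (isUnit (mul minusOne x) ∧ inHalf (mul minusOne x))
      ≡⟨ cong (λ u → u ∧ not (u ∧ inHalf (mul minusOne x))) (isUnit-mulˡ minusOne∈G x) ⟩
    isUnit x ∧ not (isUnit x ∧ inHalf (mul minusOne x))
      ≡⟨ ∧-not-∧ (λ x-unit → inHalf-minusOne* (isUnit⇒∈G {x} x-unit)) ⟩
    isUnit x ∧ inHalf x                                       ≡⟨ lookup-A x ⟨
    lookup A x                                                ∎

module Cosets (d : ℕ) .{{_ : NonZero d}} (H : Subset d) (subgroup : Residues.IsSubgroup d H) where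
  open Residues d
  open UnitsModulo d
  open ≡ using (refl; sym; trans; cong; subst)
  open ≡.≡-Reasoning

  H⊆G : ∀ h → h ∈ H → h ∈ G
  H⊆G = proj₁ subgroup

  one∈H : one ∈ H
  one∈H = proj₁ (proj₂ subgroup)

  mul∈H : ∀ a b → a ∈ H → b ∈ H → mul a b ∈ H
  mul∈H = proj₁ (proj₂ (proj₂ subgroup))

  inverse∈H : ∀ a → a ∈ H → ∃ λ b → b ∈ H × mul a b ≡ one
  inverse∈H = proj₂ (proj₂ (proj₂ subgroup))

  mul≡one⇒∈H : ∀ {h w} → h ∈ H → mul w h ≡ one → w ∈ H
  mul≡one⇒∈H {h} {w} h∈H wh≡1 with inverse∈H h h∈H
  ... | h⁻¹ , h⁻¹∈H , hh⁻¹≡1 = subst (_∈ H) h⁻¹≡w h⁻¹∈H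
    where
    h⁻¹≡w : h⁻¹ ≡ w
    h⁻¹≡w = begin
      h⁻¹               ≡⟨ mul-identityˡ h⁻¹ ⟨
      mul one h⁻¹       ≡⟨ cong (λ z → mul z h⁻¹) wh≡1 ⟨
      mul (mul w h) h⁻¹ ≡⟨ mul-assoc w h h⁻¹ ⟩
      mul w (mul h h⁻¹) ≡⟨ cong (mul w) hh⁻¹≡1 ⟩
      mul w one         ≡⟨ mul-identityʳ w ⟩
      w                 ∎

  lookup-H-mul : ∀ {h} → h ∈ H → ∀ w → lookup H (mul h w) ≡ lookup H w
  lookup-H-mul {h} h∈H w with inverse∈H h h∈H
  ... | h⁻¹ , h⁻¹∈H , hh⁻¹≡1 = Bool-ext
    (λ hw∈H → []=⇒lookup (subst (_∈ H) h⁻¹hw≡w (mul∈H h⁻¹ (mul h w) h⁻¹∈H (lookup⇒[]= _ H hw∈H))))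
    (λ w∈H → []=⇒lookup (mul∈H h w h∈H (lookup⇒[]= w H w∈H)))
    where
    h⁻¹hw≡w : mul h⁻¹ (mul h w) ≡ w
    h⁻¹hw≡w = trans (mul-swapˡ h⁻¹ h w) (trans (sym (mul-assoc h h⁻¹ w))
                (trans (cong (λ z → mul z w) hh⁻¹≡1) (mul-identityˡ w)))

  lookup-coset : ∀ u a → lookup (coset u H) a ≡ does (any? (λ h → (h ∈? H) ×-dec (a ≟ mul u h)))
  lookup-coset u a = lookup∘tabulate _ a

  lookup-coset-one : ∀ w → lookup (coset w H) one ≡ lookup H w
  lookup-coset-one w = trans (lookup-coset w one) (Bool-ext
    (λ one∈wH → let h , h∈H , 1≡wh = does≡true⇒ (any? (λ h → (h ∈? H) ×-dec (one ≟ mul w h))) one∈wH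
                in []=⇒lookup (mul≡one⇒∈H h∈H (sym 1≡wh)))
    (λ w∈H → let w⁻¹ , w⁻¹∈H , ww⁻¹≡1 = inverse∈H w (lookup⇒[]= w H w∈H)
             in dec-true (any? (λ h → (h ∈? H) ×-dec (one ≟ mul w h))) (w⁻¹ , w⁻¹∈H , sym ww⁻¹≡1)))

  lookup-coset-mul : ∀ {a} → a ∈ G → ∀ w → lookup (coset (mul a w) H) a ≡ lookup (coset w H) one
  lookup-coset-mul {a} a∈G w = trans (lookup-coset (mul a w) a) (trans (does-⇔ (mk⇔
      (λ (h , h∈H , a≡awh) → h , h∈H , mul-cancelˡ a∈G (trans (mul-identityʳ a) (trans a≡awh (mul-assoc a w h))))
      (λ (h , h∈H , 1≡wh) → h , h∈H , trans (sym (mul-identityʳ a)) (trans (cong (mul a) 1≡wh) (sym (mul-assoc a w h)))))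
      (any? (λ h → (h ∈? H) ×-dec (a ≟ mul (mul a w) h)))
      (any? (λ h → (h ∈? H) ×-dec (one ≟ mul w h))))
    (sym (lookup-coset w one)))

module CharacterSums {c ℓ : Level} (K : Field c ℓ) (d : ℕ) .{{_ : NonZero d}} where
  open Field K hiding (zero)
  open FieldProperties K
  open Residues d
  open UnitsModulo d
  open Characters K d
  open SetoidReasoning setoid

  mul-permutation : ∀ {a} → a ∈ G → Permutation d d
  mul-permutation {a} a∈G with ∈G⇒invertible a∈G
  ... | b , ab≡1 = permutation (mul a) (mul b) (cancel a b ab≡1) (cancel b a (≡.trans (mul-comm b a) ab≡1))
    where
    cancel : ∀ x y → mul x y ≡ one → ∀ z → mul x (mul y z) ≡ z
    cancel x y xy≡1 z = ≡.trans (≡.sym (mul-assoc x y z)) (≡.trans (≡.cong (λ w → mul w z) xy≡1) (mul-identityˡ z))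

  ∑-reindex-mul : ∀ {a} → a ∈ G → (g : Fin d → Carrier) → sum g ≈ sum (λ w → g (mul a w))
  ∑-reindex-mul {a} a∈G g = trans (∑-permute g (mul-permutation a∈G)) (sum-cong-≋ (λ w → reflexive (≡.cong g (π≗mul w))))
    where
    π≗mul : ∀ w → mul-permutation a∈G ⟨$⟩ʳ w ≡ mul a w
    π≗mul w with ∈G⇒invertible a∈G
    ... | _ = ≡.refl

  module Dirichlet (χ : Fin d → Carrier) (isCharacter : IsCharacter χ) where

    χ̃ : Fin d → Carrier
    χ̃ = dirichlet χ

    χ̃-∈G : ∀ {a} → isUnit a ≡ true → χ̃ a ≡ χ a
    χ̃-∈G {a} a-unit = ≡.cong (if_then χ a else 0#) a-unit

    χ̃-∉G : ∀ {a} → isUnit a ≡ false → χ̃ a ≡ 0#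
    χ̃-∉G {a} a-nonunit = ≡.cong (if_then χ a else 0#) a-nonunit

    χ̃-mul : ∀ {a} → a ∈ G → ∀ w → χ̃ (mul a w) ≈ χ a * χ̃ w
    χ̃-mul {a} a∈G w with isUnit w in w-unit
    ... | true  = trans (reflexive (χ̃-∈G {mul a w} (≡.trans (isUnit-mulˡ a∈G w) w-unit)))
                        (proj₂ isCharacter a w a∈G (isUnit⇒∈G w-unit))
    ... | false = trans (reflexive (χ̃-∉G {mul a w} (≡.trans (isUnit-mulˡ a∈G w) w-unit))) (sym (zeroʳ (χ a)))

    ∑χ̃-invariant : ∀ {a} → a ∈ G → (g : Fin d → Carrier) → (∀ w → g (mul a w) ≡ g w) →
                  sum (λ u → χ̃ u * g u) ≈ χ a * sum (λ u → χ̃ u * g u)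
    ∑χ̃-invariant {a} a∈G g g-inv = begin
      sum (λ u → χ̃ u * g u)                 ≈⟨ ∑-reindex-mul a∈G (λ u → χ̃ u * g u) ⟩
      sum (λ w → χ̃ (mul a w) * g (mul a w)) ≈⟨ sum-cong-≋ (λ w → *-cong (χ̃-mul a∈G w) (reflexive (g-inv w))) ⟩
      sum (λ w → χ a * χ̃ w * g w)           ≈⟨ sum-cong-≋ (λ w → *-assoc (χ a) (χ̃ w) (g w)) ⟩
      sum (λ w → χ a * (χ̃ w * g w))         ≈⟨ *-distribˡ-sum (χ a) (λ w → χ̃ w * g w) ⟨
      χ a * sum (λ u → χ̃ u * g u)           ∎

    cχ≈∑A : cχ χ ≈ sum (λ a → [ lookup A a ] * χ̃ a)
    cχ≈∑A = trans (reflexive (foldr-tabulate (λ a → if inHalf a then χ̃ a else 0#) (λ a → a)))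
                  (sum-cong-≋ (λ a → trans (term a) (*-congʳ (reflexive (≡.cong [_] (≡.sym (lookup-A a)))))))
      where
      term : ∀ a → (if inHalf a then χ̃ a else 0#) ≈ [ isUnit a ∧ inHalf a ] * χ̃ a
      term a with isUnit a | inHalf a
      ... | true  | true  = sym (*-identityˡ _)
      ... | true  | false = sym (zeroˡ _)
      ... | false | true  = sym (zeroˡ _)
      ... | false | false = sym (zeroˡ _)

module Imbalance {c ℓ : Level} (K : Field c ℓ) (d : ℕ) .{{_ : NonZero d}} (2<d : 2 < d)
                 (H : Subset d) (subgroup : Residues.IsSubgroup d H) where
  open Field K hiding (zero)
  open FieldProperties K
  open Residues d
  open UnitsModulo d
  open Reflection d 2<d
  open Cosets d H subgroup
  open Characters K d
  open CharacterSums K d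
  open SetoidReasoning setoid
  open NaturalSolver commutativeSemiring using (solve; _:=_; _:*_)
  open RingProperties ring using (x[y-z]≈xy-xz; [y-z]x≈yx-zx)

  sign : Fin d → Carrier
  sign a = [ lookup A a ] - [ lookup B a ]

  sign-∉G : ∀ {a} → isUnit a ≡ false → sign a ≈ 0#
  sign-∉G {a} a-nonunit = trans (+-cong (reflexive (≡.cong [_] A≡false)) (-‿cong (reflexive (≡.cong [_] B≡false))))
                                (-‿inverseʳ 0#)
    where
    A≡false : lookup A a ≡ false
    A≡false = ≡.trans (lookup-A a) (≡.cong (_∧ inHalf a) a-nonunit)
    B≡false : lookup B a ≡ false
    B≡false = ≡.trans (lookup-B a) (≡.cong (λ u → u ∧ not (u ∧ inHalf a)) a-nonunit)

  imbalance : Fin d → Carrier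
  imbalance u = ι (∣ coset u H ∩ A ∣) - ι (∣ coset u H ∩ B ∣)

  ι-∣coset∩∣ : ∀ u (q : Subset d) → ι ∣ coset u H ∩ q ∣ ≈ sum (λ a → [ lookup (coset u H) a ] * [ lookup q a ])
  ι-∣coset∩∣ u q = trans (ι-∣∣ (coset u H ∩ q)) (sum-cong-≋ (λ a →
    trans (reflexive (≡.cong [_] (lookup-zipWith _∧_ a (coset u H) q))) ([∧] (lookup (coset u H) a) (lookup q a))))

  imbalance≈∑sign : ∀ u → imbalance u ≈ sum (λ a → [ lookup (coset u H) a ] * sign a)
  imbalance≈∑sign u = begin
    imbalance u
      ≈⟨ +-cong (ι-∣coset∩∣ u A) (-‿cong (ι-∣coset∩∣ u B)) ⟩
    sum (λ a → [ lookup (coset u H) a ] * [ lookup A a ]) - sum (λ a → [ lookup (coset u H) a ] * [ lookup B a ])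
      ≈⟨ ∑-distrib-sub (λ a → [ lookup (coset u H) a ] * [ lookup A a ]) (λ a → [ lookup (coset u H) a ] * [ lookup B a ]) ⟨
    sum (λ a → [ lookup (coset u H) a ] * [ lookup A a ] - [ lookup (coset u H) a ] * [ lookup B a ])
      ≈⟨ sum-cong-≋ (λ a → x[y-z]≈xy-xz [ lookup (coset u H) a ] [ lookup A a ] [ lookup B a ]) ⟨
    sum (λ a → [ lookup (coset u H) a ] * sign a) ∎

  module _ (χ : Fin d → Carrier) (isCharacter : IsCharacter χ) where
    open Dirichlet χ isCharacter

    ∑H : Carrier
    ∑H = sum (λ u → χ̃ u * [ lookup H u ])

    coset-sum : Fin d → Carrier
    coset-sum a = sum (λ u → χ̃ u * [ lookup (coset u H) a ])

    coset-sum-mul : ∀ {a} → a ∈ G → coset-sum a ≈ χ a * ∑H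
    coset-sum-mul {a} a∈G = begin
      coset-sum a
        ≈⟨ ∑-reindex-mul a∈G (λ u → χ̃ u * [ lookup (coset u H) a ]) ⟩
      sum (λ w → χ̃ (mul a w) * [ lookup (coset (mul a w) H) a ])
        ≈⟨ sum-cong-≋ (λ w → *-cong (χ̃-mul a∈G w)
             (reflexive (≡.cong [_] (≡.trans (lookup-coset-mul a∈G w) (lookup-coset-one w))))) ⟩
      sum (λ w → χ a * χ̃ w * [ lookup H w ])
        ≈⟨ sum-cong-≋ (λ w → *-assoc (χ a) (χ̃ w) _) ⟩
      sum (λ w → χ a * (χ̃ w * [ lookup H w ]))
        ≈⟨ *-distribˡ-sum (χ a) (λ w → χ̃ w * [ lookup H w ]) ⟨
      χ a * ∑H ∎

    coset-sum-sign : ∀ a → coset-sum a * sign a ≈ sign a * χ̃ a * ∑H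
    coset-sum-sign a with isUnit a in a-unit
    ... | true  = begin
      coset-sum a * sign a       ≈⟨ *-congʳ (coset-sum-mul (isUnit⇒∈G a-unit)) ⟩
      χ a * ∑H * sign a          ≈⟨ solve 3 (λ x s e → (x :* s) :* e := (e :* x) :* s) refl (χ a) ∑H (sign a) ⟩
      sign a * χ a * ∑H          ∎
    ... | false = trans (trans (*-congˡ (sign-∉G a-unit)) (zeroʳ _))
                        (sym (trans (*-congʳ (trans (*-congʳ (sign-∉G a-unit)) (zeroˡ _))) (zeroˡ _)))

    ∑B≈χ[-1]∑A : sum (λ a → [ lookup B a ] * χ̃ a) ≈ χ minusOne * sum (λ a → [ lookup A a ] * χ̃ a)
    ∑B≈χ[-1]∑A = begin
      sum (λ a → [ lookup B a ] * χ̃ a)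
        ≈⟨ ∑-reindex-mul minusOne∈G (λ a → [ lookup B a ] * χ̃ a) ⟩
      sum (λ x → [ lookup B (mul minusOne x) ] * χ̃ (mul minusOne x))
        ≈⟨ sum-cong-≋ (λ x → *-cong (reflexive (≡.cong [_] (B-minusOne* x))) (χ̃-mul minusOne∈G x)) ⟩
      sum (λ x → [ lookup A x ] * (χ minusOne * χ̃ x))
        ≈⟨ sum-cong-≋ (λ x → solve 3 (λ p q r → p :* (q :* r) := q :* (p :* r)) refl [ lookup A x ] (χ minusOne) (χ̃ x)) ⟩
      sum (λ x → χ minusOne * ([ lookup A x ] * χ̃ x))
        ≈⟨ *-distribˡ-sum (χ minusOne) (λ x → [ lookup A x ] * χ̃ x) ⟨
      χ minusOne * sum (λ a → [ lookup A a ] * χ̃ a) ∎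

    ∑sign : sum (λ a → sign a * χ̃ a) ≈ cχ χ - χ minusOne * cχ χ
    ∑sign = begin
      sum (λ a → sign a * χ̃ a)
        ≈⟨ sum-cong-≋ (λ a → [y-z]x≈yx-zx (χ̃ a) [ lookup A a ] [ lookup B a ]) ⟩
      sum (λ a → [ lookup A a ] * χ̃ a - [ lookup B a ] * χ̃ a)
        ≈⟨ ∑-distrib-sub (λ a → [ lookup A a ] * χ̃ a) (λ a → [ lookup B a ] * χ̃ a) ⟩
      sum (λ a → [ lookup A a ] * χ̃ a) - sum (λ a → [ lookup B a ] * χ̃ a)
        ≈⟨ +-cong (sym cχ≈∑A) (-‿cong (trans ∑B≈χ[-1]∑A (*-congˡ (sym cχ≈∑A)))) ⟩
      cχ χ - χ minusOne * cχ χ ∎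

    imbalance-transform : sum (λ u → χ̃ u * imbalance u) ≈ (cχ χ - χ minusOne * cχ χ) * ∑H
    imbalance-transform = begin
      sum (λ u → χ̃ u * imbalance u)
        ≈⟨ sum-cong-≋ (λ u → trans (*-congˡ (imbalance≈∑sign u))
                                   (*-distribˡ-sum (χ̃ u) (λ a → [ lookup (coset u H) a ] * sign a))) ⟩
      sum (λ u → sum (λ a → χ̃ u * ([ lookup (coset u H) a ] * sign a)))
        ≈⟨ ∑-comm (λ u a → χ̃ u * ([ lookup (coset u H) a ] * sign a)) ⟩
      sum (λ a → sum (λ u → χ̃ u * ([ lookup (coset u H) a ] * sign a)))
        ≈⟨ sum-cong-≋ (λ a → trans (sum-cong-≋ (λ u → sym (*-assoc (χ̃ u) [ lookup (coset u H) a ] (sign a))))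
                                   (sym (*-distribʳ-sum (sign a) (λ u → χ̃ u * [ lookup (coset u H) a ])))) ⟩
      sum (λ a → coset-sum a * sign a)
        ≈⟨ sum-cong-≋ coset-sum-sign ⟩
      sum (λ a → sign a * χ̃ a * ∑H)
        ≈⟨ *-distribʳ-sum ∑H (λ a → sign a * χ̃ a) ⟨
      sum (λ a → sign a * χ̃ a) * ∑H
        ≈⟨ *-congʳ ∑sign ⟩
      (cχ χ - χ minusOne * cχ χ) * ∑H ∎

    ∑H-trivial : TrivialOn H χ → ∑H ≈ ι ∣ H ∣
    ∑H-trivial trivial = trans (sum-cong-≋ term) (sym (ι-∣∣ H))
      where
      term : ∀ u → χ̃ u * [ lookup H u ] ≈ [ lookup H u ]
      term u with lookup H u in u∈H
      ... | true  = trans (*-identityʳ _) (trans (reflexive (χ̃-∈G (∈G⇒isUnit (H⊆G u h∈H)))) (trivial u h∈H))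
        where
        h∈H : u ∈ H
        h∈H = lookup⇒[]= u H u∈H
      ... | false = zeroʳ _

    ∑H-nontrivial : ∀ {h} → h ∈ H → ¬ (χ h ≈ 1#) → ∑H ≈ 0#
    ∑H-nontrivial {h} h∈H χh≉1 = distinct-eigenvalues χh≉1 (trans
      (sym (∑χ̃-invariant (H⊆G h h∈H) (λ u → [ lookup H u ]) (λ w → ≡.cong [_] (lookup-H-mul h∈H w))))
      (sym (*-identityˡ ∑H)))

record PrimitiveRoot {c ℓ : Level} (K : Field c ℓ) (M : ℕ) : Set (c ⊔ ℓ) where
  open Field K
  field
    ω           : Carrier
    ω^M≈1       : ω ^ M ≈ 1#
    ω-primitive : ∀ k → 0 < k → k < M → ¬ (ω ^ k ≈ 1#)

module RootOfUnity {c ℓ : Level} (K : Field c ℓ) (m : ℕ) (ρ : PrimitiveRoot K (suc m)) where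
  open Field K hiding (zero)
  open FieldProperties K
  open PrimitiveRoot ρ
  open SetoidReasoning setoid

  M : ℕ
  M = suc m

  ω^[iM]≈1 : ∀ i → ω ^ (i ℕ.* M) ≈ 1#
  ω^[iM]≈1 i = begin
    ω ^ (i ℕ.* M) ≡⟨ ≡.cong (ω ^_) (ℕP.*-comm i M) ⟩
    ω ^ (M ℕ.* i) ≈⟨ ^-* ω M i ⟩
    (ω ^ M) ^ i   ≈⟨ ^-cong i ω^M≈1 ⟩
    1# ^ i        ≈⟨ 1^n≈1 i ⟩
    1#            ∎

  ω^-mod : ∀ a → ω ^ a ≈ ω ^ (a % M)
  ω^-mod a = begin
    ω ^ a                                 ≡⟨ ≡.cong (ω ^_) (m≡m%n+[m/n]*n a M) ⟩
    ω ^ (a % M ℕ.+ (a / M) ℕ.* M)         ≈⟨ ^-+ ω (a % M) ((a / M) ℕ.* M) ⟩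
    ω ^ (a % M) * ω ^ ((a / M) ℕ.* M)     ≈⟨ *-congˡ (ω^[iM]≈1 (a / M)) ⟩
    ω ^ (a % M) * 1#                      ≈⟨ *-identityʳ _ ⟩
    ω ^ (a % M)                           ∎

  ω^≉0 : ∀ r → ¬ (ω ^ r ≈ 0#)
  ω^≉0 r ω^r≈0 = 0≉1 (begin
    0#                  ≈⟨ zeroˡ ((ω ^ r) ^ m) ⟨
    0# * (ω ^ r) ^ m    ≈⟨ *-congʳ ω^r≈0 ⟨
    ω ^ r * (ω ^ r) ^ m ≈⟨ ^-* ω r M ⟨
    ω ^ (r ℕ.* M)       ≈⟨ ω^[iM]≈1 r ⟩
    1#                  ∎)

  ω^-injective-< : ∀ {r s} → r < s → s < M → ¬ (ω ^ r ≈ ω ^ s)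
  ω^-injective-< {r} {s} r<s s<M ω^r≈ω^s =
    ω-primitive (s ∸ r) (ℕP.m<n⇒0<n∸m r<s) (ℕP.≤-<-trans (ℕP.m∸n≤m s r) s<M)
      (sym (*-cancelˡ-≉0 (ω^≉0 r) (begin
        ω ^ r * 1#          ≈⟨ *-identityʳ _ ⟩
        ω ^ r               ≈⟨ ω^r≈ω^s ⟩
        ω ^ s               ≡⟨ ≡.cong (ω ^_) (ℕP.m+[n∸m]≡n (ℕP.<⇒≤ r<s)) ⟨
        ω ^ (r ℕ.+ (s ∸ r)) ≈⟨ ^-+ ω r (s ∸ r) ⟩
        ω ^ r * ω ^ (s ∸ r) ∎)))

  ω^-≈? : ∀ a b → Dec (ω ^ a ≈ ω ^ b)
  ω^-≈? a b with ℕP.<-cmp (a % M) (b % M)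
  ... | tri≈ _ a≡b _ = yes (trans (ω^-mod a) (trans (reflexive (≡.cong (ω ^_) a≡b)) (sym (ω^-mod b))))
  ... | tri< a<b _ _ = no (λ ω^a≈ω^b →
    ω^-injective-< a<b (m%n<n b M) (trans (sym (ω^-mod a)) (trans ω^a≈ω^b (ω^-mod b))))
  ... | tri> _ _ b<a = no (λ ω^a≈ω^b →
    ω^-injective-< b<a (m%n<n a M) (trans (sym (ω^-mod b)) (trans (sym ω^a≈ω^b) (ω^-mod a))))

  ∑ω^[i*0] : ∑ℕ M (λ i → ω ^ (i ℕ.* 0)) ≈ ι M
  ∑ω^[i*0] = trans (∑ℕ-cong M (λ i → reflexive (≡.cong (ω ^_) (ℕP.*-zeroʳ i)))) (∑ℕ-1 M)

  ∑ω^[i*j] : ∀ {j} → 0 < j → j < M → ∑ℕ M (λ i → ω ^ (i ℕ.* j)) ≈ 0#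
  ∑ω^[i*j] {j} 0<j j<M = begin
    ∑ℕ M (λ i → ω ^ (i ℕ.* j)) ≈⟨ ∑ℕ-cong M (λ i → trans (reflexive (≡.cong (ω ^_) (ℕP.*-comm i j))) (^-* ω j i)) ⟩
    ∑ℕ M ((ω ^ j) ^_)          ≈⟨ geometric-sum M (ω ^ j) (trans (sym (^-* ω j M)) (ω^[iM]≈1 j)) (ω-primitive j 0<j j<M) ⟩
    0#                         ∎

module EigenProjection {c ℓ : Level} (K : Field c ℓ) (d : ℕ) .{{_ : NonZero d}}
                       (m : ℕ) (exponent : UnitsModulo.IsExponent d (suc m)) (ρ : PrimitiveRoot K (suc m)) where
  open Field K hiding (zero)
  open FieldProperties K
  open Residues d
  open UnitsModulo d
  open PrimitiveRoot ρ
  open RootOfUnity K m ρ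
  open SetoidReasoning setoid
  open NaturalSolver commutativeSemiring using (solve; _:=_; _:*_)

  -- M times the component of F on which translation by g acts as ω^(−i) = ω^(i·m)
  project : Fin d → ℕ → (Fin d → Carrier) → Fin d → Carrier
  project g i F x = ∑ℕ M (λ j → ω ^ (i ℕ.* j) * F (mul (pow g j) x))

  ∑-project : ∀ g F x → ∑ℕ M (λ i → project g i F x) ≈ ι M * F x
  ∑-project g F x = begin
    ∑ℕ M (λ i → project g i F x)
      ≈⟨ ∑ℕ-comm M M (λ i j → ω ^ (i ℕ.* j) * F (mul (pow g j) x)) ⟩
    ∑ℕ M (λ j → ∑ℕ M (λ i → ω ^ (i ℕ.* j) * F (mul (pow g j) x)))
      ≈⟨ ∑ℕ-cong M (λ j → sym (*-distribʳ-∑ℕ M (F (mul (pow g j) x)) (λ i → ω ^ (i ℕ.* j)))) ⟩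
    ∑ℕ M (λ j → ∑ℕ M (λ i → ω ^ (i ℕ.* j)) * F (mul (pow g j) x))
      ≈⟨ +-cong (*-cong ∑ω^[i*0] (reflexive (≡.cong F (mul-identityˡ x))))
                (∑ℕ-zero m (λ j j<m → trans (*-congʳ (∑ω^[i*j] (s≤s z≤n) (s≤s j<m))) (zeroˡ _))) ⟩
    ι M * F x + 0#
      ≈⟨ +-identityʳ _ ⟩
    ι M * F x ∎

  project-eigen : ∀ {g} → g ∈ G → ∀ i F x → project g i F (mul g x) ≈ ω ^ (i ℕ.* m) * project g i F x
  project-eigen {g} g∈G i F x = *-cancelˡ-≉0 (ω^≉0 i) (begin
    ω ^ i * project g i F (mul g x)
      ≈⟨ *-distribˡ-∑ℕ M (ω ^ i) (λ j → ω ^ (i ℕ.* j) * F (mul (pow g j) (mul g x))) ⟩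
    ∑ℕ M (λ j → ω ^ i * (ω ^ (i ℕ.* j) * F (mul (pow g j) (mul g x))))
      ≈⟨ ∑ℕ-cong M shift ⟩
    ∑ℕ M (λ j → term (suc j))
      ≈⟨ ∑ℕ-rotate M term termᴹ≈term₀ ⟩
    project g i F x
      ≈⟨ *-identityˡ _ ⟨
    1# * project g i F x
      ≈⟨ *-congʳ ω^i*ω^[im]≈1 ⟨
    ω ^ i * ω ^ (i ℕ.* m) * project g i F x
      ≈⟨ *-assoc _ _ _ ⟩
    ω ^ i * (ω ^ (i ℕ.* m) * project g i F x) ∎)
    where
    term : ℕ → Carrier
    term j = ω ^ (i ℕ.* j) * F (mul (pow g j) x)
    ω^i*ω^[im]≈1 : ω ^ i * ω ^ (i ℕ.* m) ≈ 1#
    ω^i*ω^[im]≈1 = trans (sym (^-+ ω i (i ℕ.* m))) (trans (reflexive (≡.cong (ω ^_) (≡.sym (ℕP.*-suc i m)))) (ω^[iM]≈1 i))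
    shift : ∀ j → ω ^ i * (ω ^ (i ℕ.* j) * F (mul (pow g j) (mul g x))) ≈ term (suc j)
    shift j = trans (sym (*-assoc _ _ _)) (*-cong
      (trans (sym (^-+ ω i (i ℕ.* j))) (reflexive (≡.cong (ω ^_) (≡.sym (ℕP.*-suc i j)))))
      (reflexive (≡.cong F (≡.trans (≡.sym (mul-assoc (pow g j) g x)) (≡.cong (λ z → mul z x) (mul-comm (pow g j) g))))))
    termᴹ≈term₀ : term M ≈ term 0
    termᴹ≈term₀ = *-cong (trans (ω^[iM]≈1 i) (reflexive (≡.cong (ω ^_) (≡.sym (ℕP.*-zeroʳ i)))))
                         (reflexive (≡.cong (λ z → F (mul z x)) (exponent g∈G)))

  project-preserves-eigen : ∀ g i F h b → (∀ x → F (mul h x) ≈ ω ^ b * F x) →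
                            ∀ x → project g i F (mul h x) ≈ ω ^ b * project g i F x
  project-preserves-eigen g i F h b F-eigen x =
    trans (∑ℕ-cong M term) (sym (*-distribˡ-∑ℕ M (ω ^ b) (λ j → ω ^ (i ℕ.* j) * F (mul (pow g j) x))))
    where
    term : ∀ j → ω ^ (i ℕ.* j) * F (mul (pow g j) (mul h x)) ≈ ω ^ b * (ω ^ (i ℕ.* j) * F (mul (pow g j) x))
    term j = trans (*-congˡ (trans (reflexive (≡.cong F (mul-swapˡ (pow g j) h x))) (F-eigen (mul (pow g j) x))))
                   (solve 3 (λ p q r → p :* (q :* r) := q :* (p :* r)) refl _ _ _)

module CharacterDetection {c ℓ : Level} (K : Field c ℓ) (charZero : Field.CharZero K) (d : ℕ) .{{_ : NonZero d}}
                          (m : ℕ) (exponent : UnitsModulo.IsExponent d (suc m)) (ρ : PrimitiveRoot K (suc m)) where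
  open Field K hiding (zero)
  open FieldProperties K
  open Residues d
  open UnitsModulo d
  open Characters K d
  open PrimitiveRoot ρ
  open RootOfUnity K m ρ
  open EigenProjection K d m exponent ρ
  open SetoidReasoning setoid
  open NaturalSolver commutativeSemiring using (solve; _:=_; _:*_)

  Eigenvector : (Fin d → Carrier) → Fin d → Set ℓ
  Eigenvector F g = ∃ λ b → ∀ x → F (mul g x) ≈ ω ^ b * F x

  module _ (f : Fin d → Carrier)
           (orthogonal : ∀ (e : Fin d → ℕ) → IsCharacter (λ g → ω ^ e g) →
                         sum (λ u → dirichlet (λ g → ω ^ e g) u * f u) ≈ 0#) where

    ⟨f,_⟩ : (Fin d → Carrier) → Carrier
    ⟨f, F ⟩ = sum (λ y → dirichlet f y * F y)

    ⟨f,project⟩ : ∀ g F → ∑ℕ M (λ i → ⟨f, project g i F ⟩) ≈ ι M * ⟨f, F ⟩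
    ⟨f,project⟩ g F = begin
      ∑ℕ M (λ i → ⟨f, project g i F ⟩)
        ≈⟨ ∑-∑ℕ-comm M (λ y i → dirichlet f y * project g i F y) ⟨
      sum (λ y → ∑ℕ M (λ i → dirichlet f y * project g i F y))
        ≈⟨ sum-cong-≋ (λ y → sym (*-distribˡ-∑ℕ M (dirichlet f y) (λ i → project g i F y))) ⟩
      sum (λ y → dirichlet f y * ∑ℕ M (λ i → project g i F y))
        ≈⟨ sum-cong-≋ (λ y → *-congˡ (∑-project g F y)) ⟩
      sum (λ y → dirichlet f y * (ι M * F y))
        ≈⟨ sum-cong-≋ (λ y → solve 3 (λ p q r → p :* (q :* r) := q :* (p :* r)) refl (dirichlet f y) (ι M) (F y)) ⟩
      sum (λ y → ι M * (dirichlet f y * F y))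
        ≈⟨ *-distribˡ-sum (ι M) (λ y → dirichlet f y * F y) ⟨
      ι M * ⟨f, F ⟩ ∎

    module SimultaneousEigenvector (F : Fin d → Carrier) (eigen : ∀ g → g ∈ G → Eigenvector F g) where

      e : Fin d → ℕ
      e g with g ∈? G
      ... | yes g∈G = proj₁ (eigen g g∈G)
      ... | no  _   = 0

      e-eigen : ∀ {g} → g ∈ G → ∀ x → F (mul g x) ≈ ω ^ e g * F x
      e-eigen {g} g∈G with g ∈? G
      ... | yes g∈G′ = proj₂ (eigen g g∈G′)
      ... | no  g∉G  = ⊥-elim (g∉G g∈G)

      μ : Fin d → Carrier
      μ g = ω ^ e g

      Vanishes : Set ℓ
      Vanishes = ∀ x → F x ≈ 0#

      μ-one : μ one ≈ 1# ⊎ Vanishes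
      μ-one with ω^-≈? (e one) 0
      ... | yes μ1≈1 = inj₁ μ1≈1
      ... | no  μ1≉1 = inj₂ λ x → distinct-eigenvalues μ1≉1 (begin
        μ one * F x   ≈⟨ e-eigen one∈G x ⟨
        F (mul one x) ≡⟨ ≡.cong F (mul-identityˡ x) ⟩
        F x           ≈⟨ *-identityˡ (F x) ⟨
        1# * F x      ∎)

      μ-mul : ∀ a b → (a ∈ G → b ∈ G → μ (mul a b) ≈ μ a * μ b) ⊎ Vanishes
      μ-mul a b with ω^-≈? (e (mul a b)) (e a ℕ.+ e b)
      ... | yes μab≈μaμb = inj₁ (λ _ _ → trans μab≈μaμb (^-+ ω (e a) (e b)))
      ... | no  μab≉μaμb = by-membership (a ∈? G) (b ∈? G)
        where
        by-membership : Dec (a ∈ G) → Dec (b ∈ G) → (a ∈ G → b ∈ G → μ (mul a b) ≈ μ a * μ b) ⊎ Vanishes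
        by-membership (no a∉G) _         = inj₁ (λ a∈G _ → ⊥-elim (a∉G a∈G))
        by-membership _        (no b∉G)  = inj₁ (λ _ b∈G → ⊥-elim (b∉G b∈G))
        by-membership (yes a∈G) (yes b∈G) = inj₂ λ x → distinct-eigenvalues μab≉μaμb (begin
          μ (mul a b) * F x           ≈⟨ e-eigen (mul∈G a∈G b∈G) x ⟨
          F (mul (mul a b) x)         ≡⟨ ≡.cong F (mul-assoc a b x) ⟩
          F (mul a (mul b x))         ≈⟨ e-eigen a∈G (mul b x) ⟩
          μ a * F (mul b x)           ≈⟨ *-congˡ (e-eigen b∈G x) ⟩
          μ a * (μ b * F x)           ≈⟨ *-assoc _ _ _ ⟨
          μ a * μ b * F x             ≈⟨ *-congʳ (^-+ ω (e a) (e b)) ⟨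
          ω ^ (e a ℕ.+ e b) * F x     ∎)

      character-or-vanishing : IsCharacter μ ⊎ Vanishes
      character-or-vanishing with μ-one | ∀[P⊎Q]⇒∀P⊎Q (λ a → ∀[P⊎Q]⇒∀P⊎Q (μ-mul a))
      ... | inj₂ vanishes | _              = inj₂ vanishes
      ... | inj₁ _        | inj₂ vanishes  = inj₂ vanishes
      ... | inj₁ μ1≈1     | inj₁ μ-mul-all = inj₁ (μ1≈1 , μ-mul-all)

      orthogonal-to-f : ⟨f, F ⟩ ≈ 0#
      orthogonal-to-f with character-or-vanishing
      ... | inj₂ vanishes    = ∑-zero _ (λ y → trans (*-congˡ (vanishes y)) (zeroʳ _))
      ... | inj₁ isCharacter = begin
        ⟨f, F ⟩                                     ≈⟨ sum-cong-≋ factor ⟩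
        sum (λ y → dirichlet μ y * f y * F one)      ≈⟨ *-distribʳ-sum (F one) (λ y → dirichlet μ y * f y) ⟨
        sum (λ y → dirichlet μ y * f y) * F one      ≈⟨ *-congʳ (orthogonal e isCharacter) ⟩
        0# * F one                                   ≈⟨ zeroˡ _ ⟩
        0#                                           ∎
        where
        factor : ∀ y → dirichlet f y * F y ≈ dirichlet μ y * f y * F one
        factor y with isUnit y in y-unit
        ... | false = trans (zeroˡ _) (sym (trans (*-congʳ (zeroˡ _)) (zeroˡ _)))
        ... | true  = begin
          f y * F y                ≡⟨ ≡.cong (λ z → f y * F z) (mul-identityʳ y) ⟨
          f y * F (mul y one)      ≈⟨ *-congˡ (e-eigen (isUnit⇒∈G {y} y-unit) one) ⟩
          f y * (μ y * F one)      ≈⟨ solve 3 (λ p q r → p :* (q :* r) := q :* p :* r) refl (f y) (μ y) (F one) ⟩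
          μ y * f y * F one        ∎

    -- Induction on the list R of units for which F is not yet known to be an eigenvector:
    -- splitting F into its eigencomponents for the first of them shrinks R.
    OrthogonalBeyond : List (Fin d) → Set (c ⊔ ℓ)
    OrthogonalBeyond R = ∀ F → (∀ g → g ∈ G → g ∈ₗ R ⊎ Eigenvector F g) → ⟨f, F ⟩ ≈ 0#

    orthogonal-beyond : ∀ R → OrthogonalBeyond R
    orthogonal-beyond []      F eigen = SimultaneousEigenvector.orthogonal-to-f F eigen′
      where
      eigen′ : ∀ g → g ∈ G → Eigenvector F g
      eigen′ g g∈G with eigen g g∈G
      ... | inj₂ F-eigen = F-eigen
    orthogonal-beyond (r ∷ R) F eigen with r ∈? G
    ... | no  r∉G = orthogonal-beyond R F eigen′
      where
      eigen′ : ∀ g → g ∈ G → g ∈ₗ R ⊎ Eigenvector F g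
      eigen′ g g∈G with eigen g g∈G
      ... | inj₁ (here ≡.refl) = ⊥-elim (r∉G g∈G)
      ... | inj₁ (there g∈R)   = inj₁ g∈R
      ... | inj₂ F-eigen       = inj₂ F-eigen
    ... | yes r∈G = zero-product (charZero m) (begin
      ι M * ⟨f, F ⟩                     ≈⟨ ⟨f,project⟩ r F ⟨
      ∑ℕ M (λ i → ⟨f, project r i F ⟩)  ≈⟨ ∑ℕ-zero M (λ i _ → orthogonal-beyond R (project r i F) (component i)) ⟩
      0#                                ∎)
      where
      component : ∀ i g → g ∈ G → g ∈ₗ R ⊎ Eigenvector (project r i F) g
      component i g g∈G with eigen g g∈G
      ... | inj₁ (here ≡.refl)   = inj₂ (i ℕ.* m , project-eigen r∈G i F)
      ... | inj₁ (there g∈R)     = inj₁ g∈R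
      ... | inj₂ (b , F-eigen)   = inj₂ (b , project-preserves-eigen r i F g b F-eigen)

    vanishes-on-G : ∀ v → v ∈ G → f v ≈ 0#
    vanishes-on-G v v∈G = begin
      f v                                       ≡⟨ ≡.cong (if_then f v else 0#) (∈G⇒isUnit v∈G) ⟨
      dirichlet f v                             ≈⟨ ∑-select (dirichlet f) v ⟨
      ⟨f, (λ x → [ does (x ≟ v) ]) ⟩            ≈⟨ orthogonal-beyond (List.allFin d) _ (λ g _ → inj₁ (∈-allFin g)) ⟩
      0#                                        ∎

module BalanceCriterion {c ℓ : Level} (K : Field c ℓ) (charZero : Field.CharZero K)
                        (d : ℕ) .{{_ : NonZero d}} (2<d : 2 < d)
                        (H : Subset d) (subgroup : Residues.IsSubgroup d H) where
  open Field K hiding (zero)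
  open FieldProperties K
  open Residues d
  open UnitsModulo d
  open Cosets d H subgroup
  open Characters K d
  open Imbalance K d 2<d H subgroup
  open SetoidReasoning setoid
  open RingProperties ring using (-1*x≈-x; -‿involutive)
  open AbelianGroupProperties +-abelianGroup using (x∙y⁻¹≈ε⇒x≈y)

  ι∣H∣≉0 : ¬ (ι ∣ H ∣ ≈ 0#)
  ι∣H∣≉0 with ∣ H ∣ | x∈p⇒0<∣p∣ one∈H
  ... | suc n | _ = charZero n

  balanced⇒transform≈0 : Balanced H → ∀ χ → IsCharacter χ → sum (λ u → dirichlet χ u * imbalance u) ≈ 0#
  balanced⇒transform≈0 balanced χ _ = ∑-zero _ term
    where
    term : ∀ u → dirichlet χ u * imbalance u ≈ 0#
    term u with isUnit u in u-unit
    ... | true  = trans (*-congˡ (imbalance≈0 (balanced u (isUnit⇒∈G u-unit)))) (zeroʳ _)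
      where
      imbalance≈0 : ∣ coset u H ∩ A ∣ ≡ ∣ coset u H ∩ B ∣ → imbalance u ≈ 0#
      imbalance≈0 equal = trans (+-congʳ (reflexive (≡.cong ι equal))) (-‿inverseʳ _)
    ... | false = zeroˡ _

  balanced⇒cχ≈0 : Balanced H → ∀ χ → IsCharacter χ → Odd χ → TrivialOn H χ → cχ χ ≈ 0#
  balanced⇒cχ≈0 balanced χ isCharacter odd trivial =
    zero-product (1+1≉0 charZero) (zero-product ι∣H∣≉0 (begin
      ι ∣ H ∣ * ((1# + 1#) * cχ χ)                  ≈⟨ *-comm _ _ ⟩
      (1# + 1#) * cχ χ * ι ∣ H ∣                    ≈⟨ *-cong (sym 2c≈c-χ[-1]c) (∑H-trivial χ isCharacter trivial) ⟨
      (cχ χ - χ minusOne * cχ χ) * ∑H χ isCharacter ≈⟨ imbalance-transform χ isCharacter ⟨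
      sum (λ u → dirichlet χ u * imbalance u)       ≈⟨ balanced⇒transform≈0 balanced χ isCharacter ⟩
      0#                                            ∎))
    where
    2c≈c-χ[-1]c : (1# + 1#) * cχ χ ≈ cχ χ - χ minusOne * cχ χ
    2c≈c-χ[-1]c = begin
      (1# + 1#) * cχ χ               ≈⟨ distribʳ (cχ χ) 1# 1# ⟩
      1# * cχ χ + 1# * cχ χ          ≈⟨ +-cong (*-identityˡ _) (*-identityˡ _) ⟩
      cχ χ + cχ χ                    ≈⟨ +-congˡ (-‿involutive (cχ χ)) ⟨
      cχ χ - - cχ χ                  ≈⟨ +-congˡ (-‿cong (-1*x≈-x (cχ χ))) ⟨
      cχ χ - - 1# * cχ χ             ≈⟨ +-congˡ (-‿cong (*-congʳ odd)) ⟨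
      cχ χ - χ minusOne * cχ χ       ∎

  module _ (m : ℕ) (exponent : IsExponent (suc m)) (ρ : PrimitiveRoot K (suc m)) where
    open Reflection d 2<d using (minusOne²; minusOne∈G)
    open PrimitiveRoot ρ using (ω)
    open RootOfUnity K m ρ using (ω^-≈?)
    open CharacterDetection K charZero d m exponent ρ using (vanishes-on-G)

    module _ (odd-trivial⇒cχ≈0 : ∀ χ → IsCharacter χ → Odd χ → TrivialOn H χ → cχ χ ≈ 0#)
             (e : Fin d → ℕ) (isCharacter : IsCharacter (λ g → ω ^ e g)) where

      μ : Fin d → Carrier
      μ g = ω ^ e g

      trivial-at-or-∑H≈0 : ∀ h → (h ∈ H → μ h ≈ 1#) ⊎ ∑H μ isCharacter ≈ 0#
      trivial-at-or-∑H≈0 h with h ∈? H | ω^-≈? (e h) 0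
      ... | no  h∉H | _       = inj₁ (λ h∈H → ⊥-elim (h∉H h∈H))
      ... | yes _   | yes μh≈1 = inj₁ (λ _ → μh≈1)
      ... | yes h∈H | no μh≉1  = inj₂ (∑H-nontrivial μ isCharacter h∈H μh≉1)

      trivial⇒cμ-μ[-1]cμ≈0 : TrivialOn H μ → cχ μ - μ minusOne * cχ μ ≈ 0#
      trivial⇒cμ-μ[-1]cμ≈0 trivial with ω^-≈? (e minusOne) 0
      ... | yes μ[-1]≈1 = trans (+-congˡ (-‿cong (trans (*-congʳ μ[-1]≈1) (*-identityˡ _)))) (-‿inverseʳ _)
      ... | no  μ[-1]≉1 = trans (+-cong cμ≈0 (-‿cong (trans (*-congˡ cμ≈0) (zeroʳ _)))) (-‿inverseʳ 0#)
        where
        μ[-1]²≈1 : μ minusOne * μ minusOne ≈ 1#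
        μ[-1]²≈1 = trans (sym (proj₂ isCharacter minusOne minusOne minusOne∈G minusOne∈G))
                         (trans (reflexive (≡.cong μ minusOne²)) (proj₁ isCharacter))
        cμ≈0 : cχ μ ≈ 0#
        cμ≈0 = odd-trivial⇒cχ≈0 μ isCharacter (x²≈1⇒x≈-1 μ[-1]²≈1 μ[-1]≉1) trivial

      μ-transform≈0 : sum (λ u → dirichlet μ u * imbalance u) ≈ 0#
      μ-transform≈0 with ∀[P⊎Q]⇒∀P⊎Q trivial-at-or-∑H≈0
      ... | inj₁ trivial = trans (imbalance-transform μ isCharacter)
                                 (trans (*-congʳ (trivial⇒cμ-μ[-1]cμ≈0 trivial)) (zeroˡ _))
      ... | inj₂ ∑H≈0    = trans (imbalance-transform μ isCharacter) (trans (*-congˡ ∑H≈0) (zeroʳ _))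

    cχ≈0⇒balanced : (∀ χ → IsCharacter χ → Odd χ → TrivialOn H χ → cχ χ ≈ 0#) → Balanced H
    cχ≈0⇒balanced odd-trivial⇒cχ≈0 u u∈G =
      ι-injective charZero _ _ (x∙y⁻¹≈ε⇒x≈y _ _ (vanishes-on-G imbalance (μ-transform≈0 odd-trivial⇒cχ≈0) u u∈G))

theorem2p1 : (K : Field 0ℓ 0ℓ) → Field.CharZero K → Field.AllRootsOfUnity K →
    (d : ℕ) .{{_ : NonZero d}} → 2 < d →
    (H : Subset d) → Residues.IsSubgroup d H →
    (Residues.Balanced d H ⇔
      ((χ : Fin d → Field.Carrier K) → Characters.IsCharacter K d χ →
        Characters.Odd K d χ → Characters.TrivialOn K d H χ →
        Field._≈_ K (Characters.cχ K d χ) (Field.0# K)))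
theorem2p1 K charZero roots d 2<d H subgroup =
  mk⇔ balanced⇒cχ≈0 (cχ≈0⇒balanced m exponent primitiveRoot)
  where
  open UnitsModulo d using (IsExponent; d!-exponent)
  open BalanceCriterion K charZero d 2<d H subgroup
  m : ℕ
  m = ℕ.pred (d ℕ.!)
  exponent : IsExponent (suc m)
  exponent = ≡.subst IsExponent (≡.sym (ℕP.suc-pred (d ℕ.!) {{d ℕP.!≢0}})) d!-exponent
  primitiveRoot : PrimitiveRoot K (suc m)
  primitiveRoot = let ω , ω^M≈1 , ω-primitive = roots (suc m) (s≤s z≤n) in record
    { ω = ω ; ω^M≈1 = ω^M≈1 ; ω-primitive = ω-primitive }
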